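{- Let $n,r,s\ge 1$ be integers and let $k$ be defined by $2k+1=(2r+1)(2s+1)$. For $1\le a\le r$, set $I_a=\{(a-1)(2s+1)+1,\dots,a(2s+1)\}$, and set $M=\{r(2s+1)+1,\dots,(r+1)(2s+1)\}$. Let $G_{2n+1}(2r+1,2s+1)$ be the simple graph with vertex set $$\{u_i,v_i: 1\le i\le 2k+1\}\cup\{Y_{a,j},Z_{a,j}: 1\le a\le r,\ 1\le j\le 2n+1\}\cup\{X_j: 1\le j\le 2n+1\}$$ and edge set consisting of - $u_iv_i$ for $1\le i\le 2k+1$; - for each $1\le a\le r$, $1\le j\le 2n+1$ and $i\in I_a$: the edges $Y_{a,j}u_i$, $Y_{a,j}v_{2k+2-i}$, $Z_{a,j}v_i$, $Z_{a,j}u_{2k+2-i}$; - for each $1\le j\le 2n+1$ and $i\in M$: the edges $X_ju_i$ and $X_jv_{2k+2-i}$. (This graph is tripartite and has $r+1$ components.) Then $\chi_{la}(G_{2n+1}(2r+1,2s+1))=3$.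
   Context: For a graph $G$ with $q$ edges, a local antimagic labeling is a bijection $f:E(G)\to\{1,2,\dots,q\}$ such that $f^+(u)\ne f^+(v)$ for every edge $uv\in E(G)$. Here $f^+(u)=\sum_{e\ni u} f(e)$ is the sum of the labels of the edges incident to $u$. The color number of $f$ is the number of distinct values of $f^+$. The local antimagic chromatic number $\chi_{la}(G)$ is the minimum color number over all local antimagic labelings of $G$. -}

module Defs where

open import Data.Nat using (ℕ; zero; suc; _+_; _*_; _∸_; _≤_; _≟_)
open import Data.Bool using (Bool; true; false; if_then_else_; _∨_)
open import Data.List using (List; []; _∷_; _++_; map; concatMap; upTo; allFin; lookup; length; deduplicate)
open import Data.Nat.ListAction using (sum)
open import Data.Fin using (Fin; toℕ)
open import Data.Product using (_×_; _,_; proj₁; proj₂; Σ)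
open import Function.Definitions using (Bijective)
open import Relation.Binary.PropositionalEquality using (_≡_; _≢_)
open import Relation.Nullary using (Dec; yes; no)
open import Relation.Nullary.Decidable using (⌊_⌋)

data V : Set where
  u v X : ℕ → V
  Y Z : ℕ → ℕ → V

_==_ : V → V → Bool
u i == u i' = ⌊ i ≟ i' ⌋
v i == v i' = ⌊ i ≟ i' ⌋
X i == X i' = ⌊ i ≟ i' ⌋
Y a j == Y a' j' = ⌊ a ≟ a' ⌋ Data.Bool.∧ ⌊ j ≟ j' ⌋
Z a j == Z a' j' = ⌊ a ≟ a' ⌋ Data.Bool.∧ ⌊ j ≟ j' ⌋
_ == _ = false

interval : ℕ → ℕ → List ℕ
interval a b = map (a +_) (upTo (suc b ∸ a))

module Graph (n r s : ℕ) where
  -- N = 2k+1 = (2r+1)(2s+1)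
  N : ℕ
  N = (2 * r + 1) * (2 * s + 1)

  I : ℕ → List ℕ
  I a = interval ((a ∸ 1) * (2 * s + 1) + 1) (a * (2 * s + 1))

  M : List ℕ
  M = interval (r * (2 * s + 1) + 1) ((r + 1) * (2 * s + 1))

  -- 2k+2-i = suc N ∸ i
  op : ℕ → ℕ
  op i = suc N ∸ i

  edges : List (V × V)
  edges =
    map (λ i → u i , v i) (interval 1 N)
    ++ concatMap (λ a → concatMap (λ j → concatMap (λ i →
         (Y a j , u i) ∷ (Y a j , v (op i)) ∷ (Z a j , v i) ∷ (Z a j , u (op i)) ∷ [])
         (I a)) (interval 1 (2 * n + 1))) (interval 1 r)
    ++ concatMap (λ j → concatMap (λ i → (X j , u i) ∷ (X j , v (op i)) ∷ []) M)
         (interval 1 (2 * n + 1))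

  vertices : List V
  vertices =
    map u (interval 1 N) ++ map v (interval 1 N)
    ++ concatMap (λ a → map (Y a) (interval 1 (2 * n + 1)) ++ map (Z a) (interval 1 (2 * n + 1)))
         (interval 1 r)
    ++ map X (interval 1 (2 * n + 1))

  q : ℕ
  q = length edges

  -- a labeling is a map Fin q → Fin q; edge e gets label toℕ (f e) + 1 ∈ {1..q}
  label : (Fin q → Fin q) → Fin q → ℕ
  label f e = suc (toℕ (f e))

  incident : V → V × V → Bool
  incident w (x , y) = (w == x) ∨ (w == y)

  fplus : (Fin q → Fin q) → V → ℕ
  fplus f w = sum (map (λ e → if incident w (lookup edges e) then label f e else 0) (allFin q))

  LocalAntimagic : (Fin q → Fin q) → Set
  LocalAntimagic f =
    Bijective {A = Fin q} _≡_ _≡_ f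
    × (∀ e → fplus f (proj₁ (lookup edges e)) ≢ fplus f (proj₂ (lookup edges e)))

  colorNumber : (Fin q → Fin q) → ℕ
  colorNumber f = length (deduplicate _≟_ (map (fplus f) vertices))

  χla≡ : ℕ → Set
  χla≡ c = Σ (Fin q → Fin q) (λ f → LocalAntimagic f × colorNumber f ≡ c)
           × (∀ f → LocalAntimagic f → c ≤ colorNumber f)

{-# OPTIONS --safe #-}

-- Write N = (2r+1)(2s+1), S = 2s+1, T = 2n+1, P = TN and op i = N+1-i. The rungs u_i v_i get
-- the labels 1..N. In each hub column j (1 ≤ j ≤ T) every u_i has exactly one hub neighbour:
-- Y_{a,j} if i ∈ I_a, X_j if i ∈ M, and Z_{a,j} if op i ∈ I_a; symmetrically for v_i. The spoke
-- from column j to u_i gets 1 + jN + σ_j(i) and the one to v_i gets 1 + P + (T+1-j)N + σ_j(i),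
-- where σ_j(i) = i-1 for j ≤ n and σ_j(i) = N-i for the other n+1 columns. Since
-- σ_j(i) + σ_j(op i) = N-1, the two spokes of a hub to u_i and v_{op i} always add up to
-- 2N+2P+1, so every hub sums to S(2N+2P+1). Because one more column uses N-i than i-1, the sum
-- at u_i does not depend on i, and pairing v_i with u_{op i} shows the same for v_i. With
-- K = 2(n+1)N the three sums are (n+1) + (n+1)K, (N+n+1) + (3n+1)K and S + 2SK; all three
-- remainders are below K (for the middle one this needs n ≥ 1), so the sums differ. Conversely, m = rS+s+1 is the centre of M, so op m = m
-- and u_m, v_m, X_1 form a triangle: at least three colours are needed.

module Submission where

open import Defs

open import Data.Bool using (Bool; true; false; if_then_else_; _∧_; _∨_)
open import Data.Bool.Properties using (∨-identityʳ)
open import Data.Fin as Fin using (Fin; punchOut; toℕ; fromℕ<)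
open import Data.Fin.Properties using (injective⇒≤; punchOut-injective; any?; toℕ-fromℕ<; toℕ-injective; toℕ<n)
open import Data.List using (List; []; _∷_; _++_; [_]; map; concatMap; upTo; allFin; lookup; length; _∷ʳ_; deduplicate)
open import Data.List.Properties using (map-tabulate; tabulate-lookup; concatMap-++; map-++; map-∘; map-cong; ++-assoc; ++-identityʳ; length-++; length-map; length-upTo; upTo-∷ʳ)
open import Data.List.Membership.Propositional using (_∈_; _∉_; find; lose)
open import Data.List.Membership.Propositional.Properties using (∈-map⁺; ∈-map⁻; ∈-++⁺ˡ; ∈-++⁺ʳ; ∈-++⁻; ∈-concatMap⁺; ∈-concatMap⁻; ∈-upTo⁺; ∈-upTo⁻; ∈-lookup; ∈-deduplicate⁺; ∈-deduplicate⁻)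
import Data.List.Membership.Setoid.Properties as SetoidMembership
open import Data.List.Relation.Binary.Subset.Propositional using (_⊆_)
open import Data.List.Relation.Unary.Any using (here; there; index)
open import Data.List.Relation.Unary.Any.Properties using (lookup-index)
open import Data.List.Relation.Unary.All using ([]; _∷_)
open import Data.List.Relation.Unary.AllPairs using ([]; _∷_)
open import Data.List.Relation.Unary.Unique.Propositional using (Unique)
open import Data.List.Relation.Unary.Unique.Propositional.Properties using (Unique[x∷xs]⇒x∉xs; map⁺; upTo⁺)
open import Data.Nat using (ℕ; zero; suc; _≤ᵇ_; _+_; _*_; _∸_; _≤_; _<_; _≟_; _≤?_; _<?_; s≤s; z≤n; s≤s⁻¹; NonZero; >-nonZero)
open import Data.List.Relation.Unary.Unique.DecPropositional.Properties _≟_ using (deduplicate-!)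
open import Data.Nat.DivMod using (_/_; _%_; [m+kn]%n≡m%n; m<n⇒m%n≡m; m<n*o⇒m/o<n; m%n<n; m≡m%n+[m/n]*n)
open import Data.Nat.ListAction using (sum)
open import Data.Nat.ListAction.Properties using (sum-++)
open import Data.Nat.Properties
open import Data.Nat.Tactic.RingSolver using (solve-∀)
open import Data.Product using (∃; _×_; _,_; proj₁; proj₂; uncurry)
open import Data.Sum using (inj₁; inj₂)
open import Function using (_∘_; id)
open import Function.Definitions using (Injective; StrictlySurjective; Bijective)
open import Function.Consequences.Propositional using (strictlySurjective⇒surjective)
open import Relation.Binary.PropositionalEquality hiding ([_])
open import Relation.Nullary using (yes; no; contradiction)
open import Relation.Nullary.Decidable using (⌊_⌋; dec-true; dec-false)

private
  variable
    A B C : Set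

∑ : List A → (A → ℕ) → ℕ
∑ xs f = sum (map f xs)

syntax ∑ xs (λ x → e) = ∑[ x ∈ xs ] e

∑-cong : ∀ (xs : List A) {f g : A → ℕ} → (∀ {x} → x ∈ xs → f x ≡ g x) → ∑ xs f ≡ ∑ xs g
∑-cong []       _  = refl
∑-cong (x ∷ xs) eq = cong₂ _+_ (eq (here refl)) (∑-cong xs (eq ∘ there))

∑-0 : ∀ (xs : List A) → ∑[ x ∈ xs ] 0 ≡ 0
∑-0 []       = refl
∑-0 (x ∷ xs) = ∑-0 xs

∑-const : ∀ (xs : List A) c → ∑[ x ∈ xs ] c ≡ length xs * c
∑-const []       c = refl
∑-const (x ∷ xs) c = cong (c +_) (∑-const xs c)

∑-+ : ∀ (xs : List A) (f g : A → ℕ) → ∑[ x ∈ xs ] (f x + g x) ≡ ∑ xs f + ∑ xs g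
∑-+ []       f g = refl
∑-+ (x ∷ xs) f g = trans (cong (f x + g x +_) (∑-+ xs f g)) (+-+-interchange (f x) (g x) _ _)
  where
  +-+-interchange : ∀ a b c d → (a + b) + (c + d) ≡ (a + c) + (b + d)
  +-+-interchange = solve-∀

∑-*ˡ : ∀ (xs : List A) c (f : A → ℕ) → ∑[ x ∈ xs ] (c * f x) ≡ c * ∑ xs f
∑-*ˡ []       c f = sym (*-zeroʳ c)
∑-*ˡ (x ∷ xs) c f = trans (cong (c * f x +_) (∑-*ˡ xs c f)) (sym (*-distribˡ-+ c (f x) _))

∑-*ʳ : ∀ (xs : List A) (f : A → ℕ) c → ∑[ x ∈ xs ] (f x * c) ≡ ∑ xs f * c
∑-*ʳ []       f c = refl
∑-*ʳ (x ∷ xs) f c = trans (cong (f x * c +_) (∑-*ʳ xs f c)) (sym (*-distribʳ-+ c (f x) _))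

∑-++ : ∀ (xs ys : List A) (f : A → ℕ) → ∑ (xs ++ ys) f ≡ ∑ xs f + ∑ ys f
∑-++ xs ys f = trans (cong sum (map-++ f xs ys)) (sum-++ (map f xs) (map f ys))

∑-map : ∀ (g : A → B) (xs : List A) (f : B → ℕ) → ∑ (map g xs) f ≡ ∑ xs (f ∘ g)
∑-map g xs f = cong sum (sym (map-∘ xs))

∑-concatMap : ∀ (F : A → List B) (xs : List A) (f : B → ℕ) → ∑ (concatMap F xs) f ≡ ∑[ x ∈ xs ] ∑ (F x) f
∑-concatMap F []       f = refl
∑-concatMap F (x ∷ xs) f = trans (∑-++ (F x) (concatMap F xs) f) (cong (∑ (F x) f +_) (∑-concatMap F xs f))

∑-separable : ∀ (xs : List A) (ys : List B) (f : A → ℕ) (g : B → ℕ) →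
              ∑[ y ∈ ys ] ∑[ x ∈ xs ] (f x * g y) ≡ ∑ xs f * ∑ ys g
∑-separable xs ys f g = trans (∑-cong ys (λ {y} _ → ∑-*ʳ xs f (g y))) (∑-*ˡ ys (∑ xs f) g)

∑-concatMap-separable : ∀ (F : A → List B) xs (ys : List C) (c : B → ℕ) (g : C → ℕ) →
  ∑[ x ∈ xs ] ∑[ y ∈ ys ] ∑[ z ∈ F x ] (c z * g y) ≡ ∑ (concatMap F xs) c * ∑ ys g
∑-concatMap-separable F xs ys c g = begin
  ∑[ x ∈ xs ] ∑[ y ∈ ys ] ∑[ z ∈ F x ] (c z * g y) ≡⟨ ∑-cong xs (λ {x} _ → ∑-separable (F x) ys c g) ⟩
  ∑[ x ∈ xs ] (∑ (F x) c * ∑ ys g)                ≡⟨ ∑-*ʳ xs (λ x → ∑ (F x) c) (∑ ys g) ⟩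
  ∑[ x ∈ xs ] ∑ (F x) c * ∑ ys g                  ≡⟨ cong (_* ∑ ys g) (∑-concatMap F xs c) ⟨
  ∑ (concatMap F xs) c * ∑ ys g                   ∎
  where open ≡-Reasoning

length-concatMap : ∀ (F : A → List B) xs → length (concatMap F xs) ≡ ∑[ x ∈ xs ] length (F x)
length-concatMap F []       = refl
length-concatMap F (x ∷ xs) = trans (length-++ (F x)) (cong (length (F x) +_) (length-concatMap F xs))

length-concatMap-const : ∀ (F : A → List B) xs {c} → (∀ {x} → x ∈ xs → length (F x) ≡ c) → length (concatMap F xs) ≡ length xs * c
length-concatMap-const F xs {c} eq = trans (length-concatMap F xs) (trans (∑-cong xs eq) (∑-const xs c))

∈-concatMap⁻-∃ : ∀ (F : A → List B) xs {y} → y ∈ concatMap F xs → ∃ λ x → x ∈ xs × y ∈ F x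
∈-concatMap⁻-∃ F xs y∈ = find (∈-concatMap⁻ F y∈)

∈-concatMap⁺-∃ : ∀ (F : A → List B) {xs x y} → x ∈ xs → y ∈ F x → y ∈ concatMap F xs
∈-concatMap⁺-∃ F x∈ y∈ = ∈-concatMap⁺ F (lose x∈ y∈)

𝟙 : Bool → ℕ
𝟙 true  = 1
𝟙 false = 0

if-then-0 : ∀ b m → (if b then m else 0) ≡ 𝟙 b * m
if-then-0 true  m = sym (+-identityʳ m)
if-then-0 false m = refl

𝟙-∧ : ∀ b c → 𝟙 (b ∧ c) ≡ 𝟙 b * 𝟙 c
𝟙-∧ true  c = sym (+-identityʳ (𝟙 c))
𝟙-∧ false c = refl

if-+-if : ∀ b m m′ → (if b ∨ false then m else 0) + ((if b ∨ false then m′ else 0) + 0) ≡ 𝟙 b * (m + m′)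
if-+-if true  m m′ = trans (cong (m +_) (+-identityʳ m′)) (sym (*-identityˡ (m + m′)))
if-+-if false m m′ = refl

δ : ℕ → ℕ → ℕ
δ x y = 𝟙 ⌊ x ≟ y ⌋

δ-≡ : ∀ {x y} → x ≡ y → δ x y ≡ 1
δ-≡ {x} {y} x≡y with x ≟ y
... | yes _   = refl
... | no  x≢y = contradiction x≡y x≢y

δ-≢ : ∀ {x y} → x ≢ y → δ x y ≡ 0
δ-≢ {x} {y} x≢y with x ≟ y
... | yes x≡y = contradiction x≡y x≢y
... | no  _   = refl

δ-subst : ∀ x y (g : ℕ → ℕ) → δ x y * g y ≡ δ x y * g x
δ-subst x y g with x ≟ y
... | yes refl = refl
... | no  _    = refl

δ-cong : ∀ {x y x′ y′} → (x ≡ y → x′ ≡ y′) → (x′ ≡ y′ → x ≡ y) → δ x y ≡ δ x′ y′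
δ-cong {x} {y} to from with x ≟ y
... | yes x≡y = sym (δ-≡ (to x≡y))
... | no  x≢y = sym (δ-≢ (x≢y ∘ from))

if-δ : ∀ x y (g : ℕ → ℕ) → (if ⌊ x ≟ y ⌋ then g y else 0) ≡ δ x y * g x
if-δ x y g = trans (if-then-0 ⌊ x ≟ y ⌋ (g y)) (δ-subst x y g)

if-δ-+-if-δ : ∀ x y y′ (g : ℕ → ℕ) →
  (if ⌊ x ≟ y ⌋ then g y else 0) + ((if ⌊ x ≟ y′ ⌋ then g y′ else 0) + 0) ≡ (δ x y + δ x y′) * g x
if-δ-+-if-δ x y y′ g = begin
  (if ⌊ x ≟ y ⌋ then g y else 0) + ((if ⌊ x ≟ y′ ⌋ then g y′ else 0) + 0)
    ≡⟨ cong₂ (λ a b → a + (b + 0)) (if-δ x y g) (if-δ x y′ g) ⟩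
  δ x y * g x + (δ x y′ * g x + 0)  ≡⟨ cong (δ x y * g x +_) (+-identityʳ _) ⟩
  δ x y * g x + δ x y′ * g x        ≡⟨ *-distribʳ-+ (g x) (δ x y) (δ x y′) ⟨
  (δ x y + δ x y′) * g x            ∎
  where open ≡-Reasoning

occurrences : ℕ → List ℕ → ℕ
occurrences x xs = ∑ xs (δ x)

occurrences-∉ : ∀ {x} xs → x ∉ xs → occurrences x xs ≡ 0
occurrences-∉ []       _   = refl
occurrences-∉ (y ∷ xs) x∉ = cong₂ _+_ (δ-≢ (x∉ ∘ here)) (occurrences-∉ xs (x∉ ∘ there))

occurrences-∈ : ∀ {x xs} → Unique xs → x ∈ xs → occurrences x xs ≡ 1
occurrences-∈ {xs = y ∷ xs} uniq (here refl) = cong₂ _+_ (δ-≡ refl) (occurrences-∉ xs (Unique[x∷xs]⇒x∉xs uniq))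
occurrences-∈ {xs = y ∷ xs} uniq@(_ ∷ uniq′) (there x∈) =
  cong₂ _+_ (δ-≢ λ { refl → Unique[x∷xs]⇒x∉xs uniq x∈ }) (occurrences-∈ uniq′ x∈)

∑-δ : ∀ {x xs} (g : ℕ → ℕ) → Unique xs → x ∈ xs → ∑[ y ∈ xs ] (δ x y * g y) ≡ g x
∑-δ {x} {xs} g uniq x∈ = begin
  ∑[ y ∈ xs ] (δ x y * g y) ≡⟨ ∑-cong xs (λ {y} _ → δ-subst x y g) ⟩
  ∑[ y ∈ xs ] (δ x y * g x) ≡⟨ ∑-*ʳ xs (δ x) (g x) ⟩
  occurrences x xs * g x    ≡⟨ cong (_* g x) (occurrences-∈ uniq x∈) ⟩
  1 * g x                   ≡⟨ *-identityˡ (g x) ⟩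
  g x                       ∎
  where open ≡-Reasoning

∑-if-δ : ∀ {x xs} (g : ℕ → ℕ) → Unique xs → x ∈ xs → ∑[ y ∈ xs ] (if ⌊ x ≟ y ⌋ then g y else 0) ≡ g x
∑-if-δ {x} {xs} g uniq x∈ = trans (∑-cong xs (λ {y} _ → if-then-0 ⌊ x ≟ y ⌋ (g y))) (∑-δ g uniq x∈)

*-distribʳ-≡1 : ∀ a b c → a + b ≡ 1 → a * c + b * c ≡ c
*-distribʳ-≡1 a b c a+b≡1 = trans (sym (*-distribʳ-+ c a b)) (trans (cong (_* c) a+b≡1) (*-identityˡ c))

∈-interval⁺ : ∀ {lo hi x} → lo ≤ x → x ≤ hi → x ∈ interval lo hi
∈-interval⁺ {lo} {hi} lo≤x x≤hi =
  subst (_∈ interval lo hi) (m+[n∸m]≡n lo≤x) (∈-map⁺ (lo +_) (∈-upTo⁺ (∸-monoˡ-< (s≤s x≤hi) lo≤x)))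

∈-interval⁻ : ∀ {lo hi x} → x ∈ interval lo hi → lo ≤ x × x ≤ hi
∈-interval⁻ {lo} {hi} x∈ with ∈-map⁻ (lo +_) x∈
... | k , k∈ , refl = m≤m+n lo k , s≤s⁻¹ (subst (_≤ suc hi) (cong suc (+-comm k lo)) (m≤o∸n⇒m+n≤o (suc k) lo≤1+hi k<))
  where
  k< : k < suc hi ∸ lo
  k< = ∈-upTo⁻ k∈
  lo≤1+hi : lo ≤ suc hi
  lo≤1+hi = <⇒≤ (m∸n≢0⇒n<m λ eq → n≮0 (subst (k <_) eq k<))

interval-unique : ∀ lo hi → Unique (interval lo hi)
interval-unique lo hi = map⁺ (+-cancelˡ-≡ lo _ _) (upTo⁺ (suc hi ∸ lo))

length-interval : ∀ lo hi → length (interval lo hi) ≡ suc hi ∸ lo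
length-interval lo hi = trans (length-map (lo +_) (upTo (suc hi ∸ lo))) (length-upTo (suc hi ∸ lo))

occurrences-interval-∈ : ∀ {lo hi x} → lo ≤ x → x ≤ hi → occurrences x (interval lo hi) ≡ 1
occurrences-interval-∈ {lo} {hi} lo≤x x≤hi = occurrences-∈ (interval-unique lo hi) (∈-interval⁺ lo≤x x≤hi)

occurrences-interval-< : ∀ {lo hi x} → x < lo → occurrences x (interval lo hi) ≡ 0
occurrences-interval-< {lo} {hi} x<lo = occurrences-∉ (interval lo hi) (λ x∈ → <⇒≱ x<lo (proj₁ (∈-interval⁻ x∈)))

occurrences-interval-> : ∀ {lo hi x} → hi < x → occurrences x (interval lo hi) ≡ 0
occurrences-interval-> {lo} {hi} hi<x = occurrences-∉ (interval lo hi) (λ x∈ → <⇒≱ hi<x (proj₂ (∈-interval⁻ x∈)))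

upTo-+ : ∀ m k → upTo (m + k) ≡ upTo m ++ map (m +_) (upTo k)
upTo-+ m zero    = trans (cong upTo (+-identityʳ m)) (sym (++-identityʳ (upTo m)))
upTo-+ m (suc k) = begin
  upTo (m + suc k)                                ≡⟨ cong upTo (+-suc m k) ⟩
  upTo (suc (m + k))                              ≡⟨ upTo-∷ʳ (m + k) ⟨
  upTo (m + k) ∷ʳ (m + k)                         ≡⟨ cong (_∷ʳ (m + k)) (upTo-+ m k) ⟩
  (upTo m ++ map (m +_) (upTo k)) ∷ʳ (m + k)      ≡⟨ ++-assoc (upTo m) _ _ ⟩
  upTo m ++ (map (m +_) (upTo k) ∷ʳ (m + k))      ≡⟨ cong (upTo m ++_) (map-++ (m +_) (upTo k) [ k ]) ⟨
  upTo m ++ map (m +_) (upTo k ∷ʳ k)              ≡⟨ cong (λ ks → upTo m ++ map (m +_) ks) (upTo-∷ʳ k) ⟩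
  upTo m ++ map (m +_) (upTo (suc k))             ∎
  where open ≡-Reasoning

interval-++ : ∀ {lo m hi} → lo ≤ suc m → m ≤ hi → interval lo m ++ interval (suc m) hi ≡ interval lo hi
interval-++ {lo} {m} {hi} lo≤1+m m≤hi = begin
  map (lo +_) (upTo a) ++ map (suc m +_) (upTo b)          ≡⟨ cong (map (lo +_) (upTo a) ++_) shift ⟩
  map (lo +_) (upTo a) ++ map (lo +_) (map (a +_) (upTo b)) ≡⟨ map-++ (lo +_) (upTo a) _ ⟨
  map (lo +_) (upTo a ++ map (a +_) (upTo b))              ≡⟨ cong (map (lo +_)) (upTo-+ a b) ⟨
  map (lo +_) (upTo (a + b))                               ≡⟨ cong (map (lo +_) ∘ upTo) a+b≡ ⟩
  interval lo hi                                           ∎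
  where
  open ≡-Reasoning
  a b : ℕ
  a = suc m ∸ lo
  b = hi ∸ m
  shift : map (suc m +_) (upTo b) ≡ map (lo +_) (map (a +_) (upTo b))
  shift = trans (map-cong (λ k → trans (cong (_+ k) (sym (m+[n∸m]≡n lo≤1+m))) (+-assoc lo a k)) (upTo b))
                (map-∘ (upTo b))
  a+b≡ : a + b ≡ suc hi ∸ lo
  a+b≡ = trans (sym (+-∸-comm b lo≤1+m)) (cong (λ k → suc k ∸ lo) (m+[n∸m]≡n m≤hi))

interval-∷ʳ : ∀ m → interval 1 (suc m) ≡ interval 1 m ∷ʳ suc m
interval-∷ʳ m = trans (cong (map (1 +_)) (sym (upTo-∷ʳ m))) (map-++ (1 +_) (upTo m) [ m ])

∑-interval-suc : ∀ m (f : ℕ → ℕ) → ∑ (interval 1 (suc m)) f ≡ ∑ (interval 1 m) f + f (suc m)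
∑-interval-suc m f = begin
  ∑ (interval 1 (suc m)) f               ≡⟨ cong (λ js → ∑ js f) (interval-∷ʳ m) ⟩
  ∑ (interval 1 m ∷ʳ suc m) f            ≡⟨ ∑-++ (interval 1 m) [ suc m ] f ⟩
  ∑ (interval 1 m) f + (f (suc m) + 0)   ≡⟨ cong (∑ (interval 1 m) f +_) (+-identityʳ (f (suc m))) ⟩
  ∑ (interval 1 m) f + f (suc m)         ∎
  where open ≡-Reasoning

2*∑-interval : ∀ m → 2 * ∑[ j ∈ interval 1 m ] j ≡ m * suc m
2*∑-interval zero    = refl
2*∑-interval (suc m) = begin
  2 * ∑[ j ∈ interval 1 (suc m) ] j        ≡⟨ cong (2 *_) (∑-interval-suc m (λ j → j)) ⟩
  2 * (∑[ j ∈ interval 1 m ] j + suc m)    ≡⟨ *-distribˡ-+ 2 (∑[ j ∈ interval 1 m ] j) (suc m) ⟩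
  2 * ∑[ j ∈ interval 1 m ] j + 2 * suc m  ≡⟨ cong (_+ 2 * suc m) (2*∑-interval m) ⟩
  m * suc m + 2 * suc m                    ≡⟨ *-distribʳ-+ (suc m) m 2 ⟨
  (m + 2) * suc m                          ≡⟨ *-comm (m + 2) (suc m) ⟩
  suc m * (m + 2)                          ≡⟨ cong (suc m *_) (+-comm m 2) ⟩
  suc m * suc (suc m)                      ∎
  where open ≡-Reasoning

∑-threshold : ∀ m k (a b : ℕ) → ∑[ j ∈ interval 1 (m + k) ] (if j ≤ᵇ m then a else b) ≡ m * a + k * b
∑-threshold m k a b = begin
  ∑ (interval 1 (m + k)) f                                ≡⟨ cong (λ js → ∑ js f) (interval-++ (s≤s z≤n) (m≤m+n m k)) ⟨
  ∑ (interval 1 m ++ interval (suc m) (m + k)) f          ≡⟨ ∑-++ (interval 1 m) _ f ⟩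
  ∑ (interval 1 m) f + ∑ (interval (suc m) (m + k)) f     ≡⟨ cong₂ _+_ (∑-cong (interval 1 m) below) (∑-cong (interval (suc m) (m + k)) above) ⟩
  ∑[ j ∈ interval 1 m ] a + ∑[ j ∈ interval (suc m) (m + k) ] b
                                                          ≡⟨ cong₂ _+_ (∑-const (interval 1 m) a) (∑-const (interval (suc m) (m + k)) b) ⟩
  length (interval 1 m) * a + length (interval (suc m) (m + k)) * b
                                                          ≡⟨ cong₂ (λ x y → x * a + y * b) (length-interval 1 m) (length-interval (suc m) (m + k)) ⟩
  m * a + (m + k ∸ m) * b                                 ≡⟨ cong (λ x → m * a + x * b) (m+n∸m≡n m k) ⟩
  m * a + k * b                                           ∎
  where
  open ≡-Reasoning
  f : ℕ → ℕ
  f j = if j ≤ᵇ m then a else b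
  below : ∀ {j} → j ∈ interval 1 m → f j ≡ a
  below {j} j∈ = cong (if_then a else b) (dec-true (j ≤? m) (proj₂ (∈-interval⁻ j∈)))
  above : ∀ {j} → j ∈ interval (suc m) (m + k) → f j ≡ b
  above {j} j∈ = cong (if_then a else b) (dec-false (j ≤? m) (<⇒≱ (proj₁ (∈-interval⁻ j∈))))

block : ℕ → ℕ → List ℕ
block S a = interval ((a ∸ 1) * S + 1) (a * S)

concatMap-block : ∀ S m → concatMap (block S) (interval 1 m) ≡ interval 1 (m * S)
concatMap-block S zero    = refl
concatMap-block S (suc m) = begin
  concatMap (block S) (interval 1 (suc m))                    ≡⟨ cong (concatMap (block S)) (interval-∷ʳ m) ⟩
  concatMap (block S) (interval 1 m ∷ʳ suc m)                 ≡⟨ concatMap-++ (block S) (interval 1 m) [ suc m ] ⟩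
  concatMap (block S) (interval 1 m) ++ (block S (suc m) ++ []) ≡⟨ cong₂ _++_ (concatMap-block S m) (++-identityʳ _) ⟩
  interval 1 (m * S) ++ interval (m * S + 1) (S + m * S)      ≡⟨ cong (λ lo → interval 1 (m * S) ++ interval lo (S + m * S)) (+-comm (m * S) 1) ⟩
  interval 1 (m * S) ++ interval (suc (m * S)) (S + m * S)    ≡⟨ interval-++ (s≤s z≤n) (m≤n+m (m * S) S) ⟩
  interval 1 (S + m * S)                                      ∎
  where open ≡-Reasoning

length-block : ∀ S a → 1 ≤ a → length (block S a) ≡ S
length-block S (suc a) _ = begin
  length (interval (a * S + 1) (S + a * S))  ≡⟨ length-interval (a * S + 1) (S + a * S) ⟩
  suc (S + a * S) ∸ (a * S + 1)              ≡⟨ cong (suc (S + a * S) ∸_) (+-comm (a * S) 1) ⟩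
  S + a * S ∸ a * S                          ≡⟨ m+n∸n≡m S (a * S) ⟩
  S                                          ∎
  where open ≡-Reasoning

lookup-injective : ∀ {xs : List A} → Unique xs → Injective _≡_ _≡_ (lookup xs)
lookup-injective {xs = x ∷ xs} _ {Fin.zero} {Fin.zero} _ = refl
lookup-injective {xs = x ∷ xs} uniq {Fin.zero} {Fin.suc j} eq =
  contradiction (subst (_∈ xs) (sym eq) (∈-lookup j)) (Unique[x∷xs]⇒x∉xs uniq)
lookup-injective {xs = x ∷ xs} uniq {Fin.suc i} {Fin.zero} eq =
  contradiction (subst (_∈ xs) eq (∈-lookup i)) (Unique[x∷xs]⇒x∉xs uniq)
lookup-injective {xs = x ∷ xs} (_ ∷ uniq) {Fin.suc i} {Fin.suc j} eq = cong Fin.suc (lookup-injective uniq eq)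

unique-⊆⇒length≤ : ∀ {xs ys : List A} → Unique xs → xs ⊆ ys → length xs ≤ length ys
unique-⊆⇒length≤ {xs = xs} uniq xs⊆ys = injective⇒≤ λ {i} {j} eq →
  lookup-injective uniq (SetoidMembership.index-injective (setoid _) (position i) (position j) eq)
  where
  position : ∀ i → lookup xs i ∈ _
  position i = xs⊆ys (∈-lookup i)

injective⇒strictlySurjective : ∀ {n} {f : Fin n → Fin n} → Injective _≡_ _≡_ f → StrictlySurjective _≡_ f
injective⇒strictlySurjective {suc n} {f} f-inj y with any? (λ x → f x Fin.≟ y)
... | yes hit = hit
... | no miss = contradiction (injective⇒≤ f′-inj) 1+n≰n
  where
  f′ : Fin (suc n) → Fin n
  f′ x = punchOut {i = y} {j = f x} (λ y≡fx → miss (x , sym y≡fx))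
  f′-inj : Injective _≡_ _≡_ f′
  f′-inj {x} {x′} eq = f-inj (punchOut-injective (λ y≡fx → miss (x , sym y≡fx)) (λ y≡fx′ → miss (x′ , sym y≡fx′)) eq)

module _ {n} {f : Fin n → Fin n} (f-surj : StrictlySurjective _≡_ f) where
  private
    g : Fin n → Fin n
    g y = proj₁ (f-surj y)

    f∘g : ∀ y → f (g y) ≡ y
    f∘g y = proj₂ (f-surj y)

    g-injective : Injective _≡_ _≡_ g
    g-injective {y} {y′} gy≡gy′ = trans (sym (f∘g y)) (trans (cong f gy≡gy′) (f∘g y′))

  strictlySurjective⇒injective : Injective _≡_ _≡_ f
  strictlySurjective⇒injective {x} {x′} fx≡fx′
    with injective⇒strictlySurjective g-injective x | injective⇒strictlySurjective g-injective x′
  ... | y , refl | y′ , refl = cong g (trans (sym (f∘g y)) (trans fx≡fx′ (f∘g y′)))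

m<n+o∧n≤m⇒m∸n<o : ∀ {m n o} → m < n + o → n ≤ m → m ∸ n < o
m<n+o∧n≤m⇒m∸n<o {m} {n} {o} m<n+o n≤m = subst (m ∸ n <_) (m+n∸m≡n n o) (∸-monoˡ-< m<n+o n≤m)

euclidean-division-unique : ∀ {K c d} x y .{{_ : NonZero K}} → c < K → d < K → c + x * K ≡ d + y * K → c ≡ d × x ≡ y
euclidean-division-unique {K} {c} {d} x y c<K d<K eq = c≡d , *-cancelʳ-≡ x y K (+-cancelˡ-≡ c _ _ (trans eq (cong (_+ y * K) (sym c≡d))))
  where
  open ≡-Reasoning
  c≡d : c ≡ d
  c≡d = begin
    c                ≡⟨ m<n⇒m%n≡m c<K ⟨
    c % K            ≡⟨ [m+kn]%n≡m%n c x K ⟨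
    (c + x * K) % K  ≡⟨ cong (_% K) eq ⟩
    (d + y * K) % K  ≡⟨ [m+kn]%n≡m%n d y K ⟩
    d % K            ≡⟨ m<n⇒m%n≡m d<K ⟩
    d                ∎

module Construction (n r s : ℕ) where
  open Graph n r s

  S T P L : ℕ
  S = 2 * s + 1
  T = 2 * n + 1
  P = T * N
  L = r * S

  columns : List ℕ
  columns = interval 1 T

  lower : List ℕ
  lower = concatMap I (interval 1 r)

  IsIndex : ℕ → Set
  IsIndex i = 1 ≤ i × i ≤ N

  N≡L+S+L : N ≡ L + S + L
  N≡L+S+L = lemma r S
    where
    lemma : ∀ r S → (2 * r + 1) * S ≡ r * S + S + r * S
    lemma = solve-∀

  1≤S : 1 ≤ S
  1≤S = m≤n+m 1 (2 * s)

  S≤N : S ≤ N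
  S≤N = subst (S ≤_) (sym N≡L+S+L) (≤-trans (m≤n+m S L) (m≤m+n (L + S) L))

  L≤N : L ≤ N
  L≤N = subst (L ≤_) (sym N≡L+S+L) (m≤n+m L (L + S))

  1≤N : 1 ≤ N
  1≤N = ≤-trans 1≤S S≤N

  N-nonZero : NonZero N
  N-nonZero = >-nonZero 1≤N

  -- I a unfolds to block S a.
  lower≡ : lower ≡ interval 1 L
  lower≡ = concatMap-block S r

  M≡ : M ≡ interval (suc L) (L + S)
  M≡ = cong₂ interval (+-comm L 1) (lemma r S)
    where
    lemma : ∀ r S → (r + 1) * S ≡ r * S + S
    lemma = solve-∀

  length-M : length M ≡ S
  length-M = trans (cong length M≡) (trans (length-interval (suc L) (L + S)) (m+n∸m≡n L S))

  op-involutive : ∀ {i} → i ≤ N → op (op i) ≡ i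
  op-involutive i≤N = m∸[m∸n]≡n (m≤n⇒m≤1+n i≤N)

  op-index : ∀ {i} → IsIndex i → IsIndex (op i)
  op-index {suc i} (_ , i<N) = m<n⇒0<n∸m i<N , m∸n≤m N i

  op-lower : ∀ {i} → i ≤ L → L + S < op i
  op-lower {i} i≤L = ≤-trans (≤-reflexive (sym 1+N∸L)) (∸-monoʳ-≤ (suc N) i≤L)
    where
    1+N∸L : suc N ∸ L ≡ suc (L + S)
    1+N∸L = trans (cong (λ m → suc m ∸ L) (trans N≡L+S+L (+-comm (L + S) L)))
                  (trans (+-∸-assoc 1 (m≤m+n L (L + S))) (cong suc (m+n∸m≡n L (L + S))))

  op-upper : ∀ {i} → L + S < i → op i ≤ L
  op-upper {i} L+S<i = ≤-trans (∸-monoʳ-≤ (suc N) L+S<i) (≤-reflexive (trans (cong (_∸ (L + S)) N≡L+S+L) (m+n∸m≡n (L + S) L)))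

  op-middle : ∀ {i} → L < i → i ≤ L + S → L < op i × op i ≤ L + S
  op-middle {i} L<i i≤L+S =
    ≤-trans (≤-reflexive (sym 1+N∸[L+S])) (∸-monoʳ-≤ (suc N) i≤L+S) ,
    ≤-trans (∸-monoʳ-≤ (suc N) L<i) (≤-reflexive N∸L)
    where
    N∸L : N ∸ L ≡ L + S
    N∸L = trans (cong (_∸ L) (trans N≡L+S+L (+-comm (L + S) L))) (m+n∸m≡n L (L + S))
    1+N∸[L+S] : suc N ∸ (L + S) ≡ suc L
    1+N∸[L+S] = trans (cong (λ m → suc m ∸ (L + S)) N≡L+S+L) (trans (+-∸-assoc 1 (m≤m+n (L + S) L)) (cong suc (m+n∸m≡n (L + S) L)))

  data Zone (i : ℕ) : Set where
    lower-zone  : i ≤ L → Zone i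
    middle-zone : L < i → i ≤ L + S → Zone i
    upper-zone  : L + S < i → Zone i

  zone : ∀ i → Zone i
  zone i with i ≤? L | i ≤? L + S
  ... | yes i≤L | _         = lower-zone i≤L
  ... | no  i≰L | yes i≤L+S = middle-zone (≰⇒> i≰L) i≤L+S
  ... | no  _   | no  i≰L+S = upper-zone (≰⇒> i≰L+S)

  -- The terms count the Y-, Z- and X-spokes at u i and, in the second component, at v i.
  SpokeMultiplicities : ℕ → Set
  SpokeMultiplicities i = occurrences i lower + occurrences (op i) lower + occurrences i M ≡ 1
                        × occurrences (op i) lower + occurrences i lower + occurrences (op i) M ≡ 1

  spoke-multiplicities : ∀ {i} → IsIndex i → SpokeMultiplicities i
  spoke-multiplicities {i} idx = by-zone (zone i)
    where
    lower-∈ : ∀ {k} → 1 ≤ k → k ≤ L → occurrences k lower ≡ 1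
    lower-∈ 1≤k k≤L = trans (cong (occurrences _) lower≡) (occurrences-interval-∈ 1≤k k≤L)
    lower-∉ : ∀ {k} → L < k → occurrences k lower ≡ 0
    lower-∉ L<k = trans (cong (occurrences _) lower≡) (occurrences-interval-> {1} {L} L<k)
    M-∈ : ∀ {k} → L < k → k ≤ L + S → occurrences k M ≡ 1
    M-∈ L<k k≤L+S = trans (cong (occurrences _) M≡) (occurrences-interval-∈ L<k k≤L+S)
    M-below : ∀ {k} → k ≤ L → occurrences k M ≡ 0
    M-below k≤L = trans (cong (occurrences _) M≡) (occurrences-interval-< {suc L} {L + S} (s≤s k≤L))
    M-above : ∀ {k} → L + S < k → occurrences k M ≡ 0
    M-above L+S<k = trans (cong (occurrences _) M≡) (occurrences-interval-> {suc L} {L + S} L+S<k)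
    L<L+S : L < L + S
    L<L+S = m<m+n L 1≤S
    by-zone : Zone i → SpokeMultiplicities i
    by-zone (lower-zone i≤L) =
      cong₂ _+_ (cong₂ _+_ (lower-∈ (proj₁ idx) i≤L) (lower-∉ (<-trans L<L+S (op-lower i≤L)))) (M-below i≤L) ,
      cong₂ _+_ (cong₂ _+_ (lower-∉ (<-trans L<L+S (op-lower i≤L))) (lower-∈ (proj₁ idx) i≤L)) (M-above (op-lower i≤L))
    by-zone (middle-zone L<i i≤L+S) =
      cong₂ _+_ (cong₂ _+_ (lower-∉ L<i) (lower-∉ (proj₁ (op-middle L<i i≤L+S)))) (M-∈ L<i i≤L+S) ,
      cong₂ _+_ (cong₂ _+_ (lower-∉ (proj₁ (op-middle L<i i≤L+S))) (lower-∉ L<i)) (uncurry M-∈ (op-middle L<i i≤L+S))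
    by-zone (upper-zone L+S<i) =
      cong₂ _+_ (cong₂ _+_ (lower-∉ (<-trans L<L+S L+S<i)) (lower-∈ (proj₁ (op-index idx)) (op-upper L+S<i))) (M-above L+S<i) ,
      cong₂ _+_ (cong₂ _+_ (lower-∈ (proj₁ (op-index idx)) (op-upper L+S<i)) (lower-∉ (<-trans L<L+S L+S<i))) (M-below (op-upper L+S<i))

  σ : ℕ → ℕ → ℕ
  σ j i = if j ≤ᵇ n then i ∸ 1 else N ∸ i

  spokeU spokeV : ℕ → ℕ → ℕ
  spokeU i j = j * N + σ j i
  spokeV i j = P + (suc T ∸ j) * N + σ j i

  column : V → ℕ
  column (X j)   = j
  column (Y _ j) = j
  column (Z _ j) = j
  column _       = 0

  -- edgeLabel p is the label of the edge p minus one, i.e. the value of f₀ in Fin q;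
  -- the final clause only concerns pairs that are not edges.
  edgeLabel : V × V → ℕ
  edgeLabel (u i , _) = i ∸ 1
  edgeLabel (h , u i) = spokeU i (column h)
  edgeLabel (h , v i) = spokeV i (column h)
  edgeLabel _         = 0

  data Hub : V → Set where
    Y-hub : ∀ {a j} → a ∈ interval 1 r → j ∈ columns → Hub (Y a j)
    Z-hub : ∀ {a j} → a ∈ interval 1 r → j ∈ columns → Hub (Z a j)
    X-hub : ∀ {j} → j ∈ columns → Hub (X j)

  hub-column : ∀ {h} → Hub h → column h ∈ columns
  hub-column (Y-hub _ j∈) = j∈
  hub-column (Z-hub _ j∈) = j∈
  hub-column (X-hub j∈)   = j∈

  edgeLabel-spoke-u : ∀ {h} i → Hub h → edgeLabel (h , u i) ≡ spokeU i (column h)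
  edgeLabel-spoke-u i (Y-hub _ _) = refl
  edgeLabel-spoke-u i (Z-hub _ _) = refl
  edgeLabel-spoke-u i (X-hub _)   = refl

  edgeLabel-spoke-v : ∀ {h} i → Hub h → edgeLabel (h , v i) ≡ spokeV i (column h)
  edgeLabel-spoke-v i (Y-hub _ _) = refl
  edgeLabel-spoke-v i (Z-hub _ _) = refl
  edgeLabel-spoke-v i (X-hub _)   = refl

  data Shape : V × V → Set where
    rung    : ∀ {i} → IsIndex i → Shape (u i , v i)
    spoke-u : ∀ {h i} → Hub h → IsIndex i → Shape (h , u i)
    spoke-v : ∀ {h i} → Hub h → IsIndex i → Shape (h , v i)

  YZ-spokes : ℕ → ℕ → ℕ → List (V × V)
  YZ-spokes a j i = (Y a j , u i) ∷ (Y a j , v (op i)) ∷ (Z a j , v i) ∷ (Z a j , u (op i)) ∷ []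

  X-spokes : ℕ → ℕ → List (V × V)
  X-spokes j i = (X j , u i) ∷ (X j , v (op i)) ∷ []

  YZ-column : ℕ → ℕ → List (V × V)
  YZ-column a j = concatMap (YZ-spokes a j) (I a)

  YZ-block : ℕ → List (V × V)
  YZ-block a = concatMap (YZ-column a) columns

  X-column : ℕ → List (V × V)
  X-column j = concatMap (X-spokes j) M

  -- edges is definitionally rungs ++ YZ-edges ++ X-edges.
  rungs YZ-edges X-edges : List (V × V)
  rungs    = map (λ i → u i , v i) (interval 1 N)
  YZ-edges = concatMap YZ-block (interval 1 r)
  X-edges  = concatMap X-column columns

  lower-index : ∀ {i} → i ∈ lower → IsIndex i
  lower-index {i} i∈ with ∈-interval⁻ (subst (i ∈_) lower≡ i∈)
  ... | 1≤i , i≤L = 1≤i , ≤-trans i≤L L≤N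

  block-index : ∀ {a i} → a ∈ interval 1 r → i ∈ I a → IsIndex i
  block-index a∈ i∈ = lower-index (∈-concatMap⁺-∃ I a∈ i∈)

  M-index : ∀ {i} → i ∈ M → IsIndex i
  M-index {i} i∈ with ∈-interval⁻ (subst (i ∈_) M≡ i∈)
  ... | L<i , i≤L+S = ≤-trans (s≤s z≤n) L<i , ≤-trans i≤L+S (subst (L + S ≤_) (sym N≡L+S+L) (m≤m+n (L + S) L))

  rung∈edges : ∀ {i} → IsIndex i → (u i , v i) ∈ edges
  rung∈edges (1≤i , i≤N) = ∈-++⁺ˡ (∈-map⁺ (λ i → u i , v i) (∈-interval⁺ 1≤i i≤N))

  YZ-spoke∈edges : ∀ {a j i p} → a ∈ interval 1 r → j ∈ columns → i ∈ I a → p ∈ YZ-spokes a j i → p ∈ edges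
  YZ-spoke∈edges {a} {j} a∈ j∈ i∈ p∈ =
    ∈-++⁺ʳ rungs (∈-++⁺ˡ (∈-concatMap⁺-∃ YZ-block a∈ (∈-concatMap⁺-∃ (YZ-column a) j∈ (∈-concatMap⁺-∃ (YZ-spokes a j) i∈ p∈))))

  X-spoke∈edges : ∀ {j i p} → j ∈ columns → i ∈ M → p ∈ X-spokes j i → p ∈ edges
  X-spoke∈edges {j} j∈ i∈ p∈ =
    ∈-++⁺ʳ rungs (∈-++⁺ʳ YZ-edges (∈-concatMap⁺-∃ X-column j∈ (∈-concatMap⁺-∃ (X-spokes j) i∈ p∈)))

  shape : ∀ {p} → p ∈ edges → Shape p
  shape p∈ with ∈-++⁻ rungs p∈
  ... | inj₁ p∈rungs with ∈-map⁻ (λ i → u i , v i) {xs = interval 1 N} p∈rungs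
  ...   | i , i∈ , refl = rung (∈-interval⁻ i∈)
  shape p∈ | inj₂ p∈hubs with ∈-++⁻ YZ-edges p∈hubs
  ... | inj₁ p∈YZ with ∈-concatMap⁻-∃ YZ-block (interval 1 r) p∈YZ
  ... | a , a∈ , p∈a with ∈-concatMap⁻-∃ (YZ-column a) columns p∈a
  ... | j , j∈ , p∈j with ∈-concatMap⁻-∃ (YZ-spokes a j) (I a) p∈j
  ... | i , i∈ , here refl                         = spoke-u (Y-hub a∈ j∈) (block-index a∈ i∈)
  ... | i , i∈ , there (here refl)                 = spoke-v (Y-hub a∈ j∈) (op-index (block-index a∈ i∈))
  ... | i , i∈ , there (there (here refl))         = spoke-v (Z-hub a∈ j∈) (block-index a∈ i∈)
  ... | i , i∈ , there (there (there (here refl))) = spoke-u (Z-hub a∈ j∈) (op-index (block-index a∈ i∈))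
  shape p∈ | inj₂ p∈hubs | inj₂ p∈X with ∈-concatMap⁻-∃ X-column columns p∈X
  ... | j , j∈ , p∈j with ∈-concatMap⁻-∃ (X-spokes j) M p∈j
  ... | i , i∈ , here refl         = spoke-u (X-hub j∈) (M-index i∈)
  ... | i , i∈ , there (here refl) = spoke-v (X-hub j∈) (op-index (M-index i∈))

  -- The labelling is a bijection

  q≡ : q ≡ N + P + P
  q≡ = begin
    length (rungs ++ YZ-edges ++ X-edges)                  ≡⟨ length-++ rungs ⟩
    length rungs + length (YZ-edges ++ X-edges)            ≡⟨ cong (length rungs +_) (length-++ YZ-edges) ⟩
    length rungs + (length YZ-edges + length X-edges)      ≡⟨ cong₂ _+_ length-rungs (cong₂ _+_ length-YZ length-X) ⟩
    N + (r * (T * (S * 4)) + T * (S * 2))                  ≡⟨ lemma r S T ⟩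
    N + P + P                                              ∎
    where
    open ≡-Reasoning
    lemma : ∀ r S T → (2 * r + 1) * S + (r * (T * (S * 4)) + T * (S * 2)) ≡ (2 * r + 1) * S + T * ((2 * r + 1) * S) + T * ((2 * r + 1) * S)
    lemma = solve-∀
    length-rungs : length rungs ≡ N
    length-rungs = trans (length-map (λ i → u i , v i) (interval 1 N)) (length-interval 1 N)
    length-YZ : length YZ-edges ≡ r * (T * (S * 4))
    length-YZ = trans (length-concatMap-const YZ-block (interval 1 r) length-YZ-block) (cong (_* (T * (S * 4))) (length-interval 1 r))
      where
      length-YZ-block : ∀ {a} → a ∈ interval 1 r → length (YZ-block a) ≡ T * (S * 4)
      length-YZ-block {a} a∈ = trans (length-concatMap-const (YZ-column a) columns λ _ →
        trans (length-concatMap-const (YZ-spokes a _) (I a) λ _ → refl) (cong (_* 4) (length-block S a (proj₁ (∈-interval⁻ a∈)))))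
        (cong (_* (S * 4)) (length-interval 1 T))
    length-X : length X-edges ≡ T * (S * 2)
    length-X = trans (length-concatMap-const X-column columns λ _ →
      trans (length-concatMap-const (X-spokes _) M λ _ → refl) (cong (_* 2) length-M)) (cong (_* (S * 2)) (length-interval 1 T))

  σ<N : ∀ j {i} → IsIndex i → σ j i < N
  σ<N j {suc i} (_ , i<N) = by-case (j ≤ᵇ n)
    where
    by-case : ∀ b → (if b then i else N ∸ suc i) < N
    by-case true  = i<N
    by-case false = ∸-monoʳ-< (s≤s z≤n) i<N

  σ-surjective : ∀ j {x} → x < N → ∃ λ i → IsIndex i × σ j i ≡ x
  σ-surjective j {x} x<N = by-case (j ≤ᵇ n)
    where
    by-case : ∀ b → ∃ λ i → IsIndex i × (if b then i ∸ 1 else N ∸ i) ≡ x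
    by-case true  = suc x , (s≤s z≤n , x<N) , refl
    by-case false = N ∸ x , (m<n⇒0<n∸m x<N , m∸n≤m N x) , m∸[m∸n]≡n (<⇒≤ x<N)

  spokeU-< : ∀ {i j} → IsIndex i → j ≤ T → spokeU i j < N + P
  spokeU-< {i} {j} idx j≤T = begin-strict
    j * N + σ j i  <⟨ +-monoʳ-< (j * N) (σ<N j idx) ⟩
    j * N + N      ≤⟨ +-monoˡ-≤ N (*-monoˡ-≤ N j≤T) ⟩
    P + N          ≡⟨ +-comm P N ⟩
    N + P          ∎
    where open ≤-Reasoning

  spokeV-< : ∀ {i j} → IsIndex i → 1 ≤ j → spokeV i j < N + P + P
  spokeV-< {i} {j} idx 1≤j = begin-strict
    P + (suc T ∸ j) * N + σ j i  <⟨ +-monoʳ-< (P + (suc T ∸ j) * N) (σ<N j idx) ⟩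
    P + (suc T ∸ j) * N + N      ≤⟨ +-monoˡ-≤ N (+-monoʳ-≤ P (*-monoˡ-≤ N (∸-monoʳ-≤ (suc T) 1≤j))) ⟩
    P + P + N                    ≡⟨ +-comm (P + P) N ⟩
    N + (P + P)                  ≡⟨ +-assoc N P P ⟨
    N + P + P                    ∎
    where open ≤-Reasoning

  edgeLabel-< : ∀ {p} → Shape p → edgeLabel p < q
  edgeLabel-< {p} shp = subst (edgeLabel p <_) (sym q≡) (bound shp)
    where
    N≤N+P+P : N ≤ N + P + P
    N≤N+P+P = ≤-trans (m≤m+n N P) (m≤m+n (N + P) P)
    bound-u : ∀ {h i} → Hub h → IsIndex i → edgeLabel (h , u i) < N + P + P
    bound-u {h} {i} hub idx = subst (_< N + P + P) (sym (edgeLabel-spoke-u i hub))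
      (<-≤-trans (spokeU-< idx (proj₂ (∈-interval⁻ (hub-column hub)))) (m≤m+n (N + P) P))
    bound-v : ∀ {h i} → Hub h → IsIndex i → edgeLabel (h , v i) < N + P + P
    bound-v {h} {i} hub idx = subst (_< N + P + P) (sym (edgeLabel-spoke-v i hub))
      (spokeV-< idx (proj₁ (∈-interval⁻ (hub-column hub))))
    bound : ∀ {p} → Shape p → edgeLabel p < N + P + P
    bound (rung {suc i} (_ , i<N)) = <-≤-trans i<N N≤N+P+P
    bound (spoke-u hub idx)       = bound-u hub idx
    bound (spoke-v hub idx)       = bound-v hub idx

  f₀ : Fin q → Fin q
  f₀ e = fromℕ< (edgeLabel-< (shape (∈-lookup {xs = edges} e)))

  toℕ-f₀ : ∀ e → toℕ (f₀ e) ≡ edgeLabel (lookup edges e)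
  toℕ-f₀ e = toℕ-fromℕ< (edgeLabel-< (shape (∈-lookup {xs = edges} e)))

  lower-block : ∀ {i} → 1 ≤ i → i ≤ L → ∃ λ a → a ∈ interval 1 r × i ∈ I a
  lower-block {i} 1≤i i≤L = ∈-concatMap⁻-∃ I (interval 1 r) (subst (i ∈_) (sym lower≡) (∈-interval⁺ 1≤i i≤L))

  middle∈M : ∀ {i} → L < i → i ≤ L + S → i ∈ M
  middle∈M {i} L<i i≤L+S = subst (i ∈_) (sym M≡) (∈-interval⁺ L<i i≤L+S)

  Spoke : (ℕ → V) → (ℕ → ℕ → ℕ) → ℕ → ℕ → Set
  Spoke end label i j = ∃ λ h → (h , end i) ∈ edges × edgeLabel (h , end i) ≡ label i j

  spoke-u-exists : ∀ {i j} → IsIndex i → j ∈ columns → Spoke u spokeU i j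
  spoke-u-exists {i} {j} idx@(1≤i , i≤N) j∈ with zone i
  ... | lower-zone i≤L with lower-block 1≤i i≤L
  ... | a , a∈ , i∈ = Y a j , YZ-spoke∈edges a∈ j∈ i∈ (here refl) , refl
  spoke-u-exists {i} {j} idx@(1≤i , i≤N) j∈ | middle-zone L<i i≤L+S =
    X j , X-spoke∈edges j∈ (middle∈M L<i i≤L+S) (here refl) , refl
  spoke-u-exists {i} {j} idx@(1≤i , i≤N) j∈ | upper-zone L+S<i
    with lower-block (proj₁ (op-index idx)) (op-upper L+S<i)
  ... | a , a∈ , opi∈ = Z a j ,
    subst (λ k → (Z a j , u k) ∈ edges) (op-involutive i≤N) (YZ-spoke∈edges a∈ j∈ opi∈ (there (there (there (here refl))))) , refl

  spoke-v-exists : ∀ {i j} → IsIndex i → j ∈ columns → Spoke v spokeV i j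
  spoke-v-exists {i} {j} idx@(1≤i , i≤N) j∈ with zone i
  ... | lower-zone i≤L with lower-block 1≤i i≤L
  ... | a , a∈ , i∈ = Z a j , YZ-spoke∈edges a∈ j∈ i∈ (there (there (here refl))) , refl
  spoke-v-exists {i} {j} idx@(1≤i , i≤N) j∈ | middle-zone L<i i≤L+S =
    X j , subst (λ k → (X j , v k) ∈ edges) (op-involutive i≤N)
            (X-spoke∈edges j∈ (uncurry middle∈M (op-middle L<i i≤L+S)) (there (here refl))) , refl
  spoke-v-exists {i} {j} idx@(1≤i , i≤N) j∈ | upper-zone L+S<i
    with lower-block (proj₁ (op-index idx)) (op-upper L+S<i)
  ... | a , a∈ , opi∈ = Y a j ,
    subst (λ k → (Y a j , v k) ∈ edges) (op-involutive i≤N) (YZ-spoke∈edges a∈ j∈ opi∈ (there (here refl))) , refl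

  divide-by-N : ∀ z → z < P → ∃ λ K → ∃ λ x → K < T × x < N × z ≡ x + K * N
  divide-by-N z z<P = z / N , z % N , m<n*o⇒m/o<n z<P , m%n<n z N , m≡m%n+[m/n]*n z N
    where
    instance
      N≢0 : NonZero N
      N≢0 = N-nonZero

  Labelled : ℕ → Set
  Labelled y = ∃ λ p → p ∈ edges × edgeLabel p ≡ y

  labelled-spoke-u : ∀ {z} → z < P → Labelled (N + z)
  labelled-spoke-u {z} z<P with divide-by-N z z<P
  ... | K , x , K<T , x<N , refl with σ-surjective (suc K) x<N
  ... | i , idx , refl with spoke-u-exists idx (∈-interval⁺ (s≤s z≤n) K<T)
  ... | h , h∈ , label≡ = (h , u i) , h∈ , trans label≡ (lemma N K (σ (suc K) i))
    where
    lemma : ∀ N K x → N + K * N + x ≡ N + (x + K * N)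
    lemma = solve-∀

  labelled-spoke-v : ∀ {z} → z < P → Labelled (N + (P + z))
  labelled-spoke-v {z} z<P with divide-by-N z z<P
  ... | K , x , K<T , x<N , refl with σ-surjective (T ∸ K) x<N
  ... | i , idx , refl with spoke-v-exists idx (∈-interval⁺ (m<n⇒0<n∸m K<T) (m∸n≤m T K))
  ... | h , h∈ , label≡ = (h , v i) , h∈ , trans label≡ (trans (cong (λ c → P + c * N + σ (T ∸ K) i) 1+T∸[T∸K]) (lemma N P K (σ (T ∸ K) i)))
    where
    1+T∸[T∸K] : suc T ∸ (T ∸ K) ≡ suc K
    1+T∸[T∸K] = trans (+-∸-assoc 1 (m∸n≤m T K)) (cong suc (m∸[m∸n]≡n (<⇒≤ K<T)))
    lemma : ∀ N P K x → P + suc K * N + x ≡ N + (P + (x + K * N))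
    lemma = solve-∀

  labelled : ∀ y → y < q → Labelled y
  labelled y y<q with y <? N
  ... | yes y<N = (u (suc y) , v (suc y)) , rung∈edges (s≤s z≤n , y<N) , refl
  ... | no  y≮N with y ∸ N <? P
  ...   | yes z<P = subst Labelled (m+[n∸m]≡n (≮⇒≥ y≮N)) (labelled-spoke-u z<P)
  ...   | no  z≮P = subst Labelled (trans (cong (N +_) (m+[n∸m]≡n (≮⇒≥ z≮P))) (m+[n∸m]≡n (≮⇒≥ y≮N))) (labelled-spoke-v z′<P)
    where
    z′<P : y ∸ N ∸ P < P
    z′<P = m<n+o∧n≤m⇒m∸n<o (m<n+o∧n≤m⇒m∸n<o (subst (y <_) (trans q≡ (+-assoc N P P)) y<q) (≮⇒≥ y≮N)) (≮⇒≥ z≮P)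

  f₀-strictlySurjective : StrictlySurjective _≡_ f₀
  f₀-strictlySurjective y = preimage (labelled (toℕ y) (toℕ<n y))
    where
    open ≡-Reasoning
    preimage : Labelled (toℕ y) → ∃ λ e → f₀ e ≡ y
    preimage (p , p∈ , label≡) = index p∈ , toℕ-injective (begin
      toℕ (f₀ (index p∈))                   ≡⟨ toℕ-f₀ (index p∈) ⟩
      edgeLabel (lookup edges (index p∈))   ≡⟨ cong edgeLabel (lookup-index p∈) ⟨
      edgeLabel p                           ≡⟨ label≡ ⟩
      toℕ y                                 ∎)

  f₀-bijective : Bijective _≡_ _≡_ f₀
  f₀-bijective = strictlySurjective⇒injective f₀-strictlySurjective , strictlySurjective⇒surjective f₀-strictlySurjective

  -- Vertex sums

  weight : V → V × V → ℕ
  weight w p = if incident w p then suc (edgeLabel p) else 0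

  ∑YZ : (ℕ → ℕ → ℕ → ℕ) → ℕ
  ∑YZ f = ∑[ a ∈ interval 1 r ] ∑[ j ∈ columns ] ∑[ k ∈ I a ] f a j k

  ∑YZ-cong : ∀ {f g} → (∀ {a j k} → a ∈ interval 1 r → j ∈ columns → k ∈ I a → f a j k ≡ g a j k) → ∑YZ f ≡ ∑YZ g
  ∑YZ-cong eq = ∑-cong (interval 1 r) λ {a} a∈ → ∑-cong columns λ j∈ → ∑-cong (I a) (eq a∈ j∈)

  ∑X : (ℕ → ℕ → ℕ) → ℕ
  ∑X f = ∑[ j ∈ columns ] ∑[ k ∈ M ] f j k

  ∑X-cong : ∀ {f g} → (∀ {j k} → j ∈ columns → k ∈ M → f j k ≡ g j k) → ∑X f ≡ ∑X g
  ∑X-cong eq = ∑-cong columns λ j∈ → ∑-cong M (eq j∈)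

  rungPart YZPart XPart : V → ℕ
  rungPart w = ∑[ i ∈ interval 1 N ] weight w (u i , v i)
  YZPart   w = ∑YZ λ a j k → ∑ (YZ-spokes a j k) (weight w)
  XPart    w = ∑X λ j k → ∑ (X-spokes j k) (weight w)

  fplus-f₀ : ∀ w → fplus f₀ w ≡ rungPart w + (YZPart w + XPart w)
  fplus-f₀ w = begin
    ∑[ e ∈ allFin q ] (if incident w (lookup edges e) then suc (toℕ (f₀ e)) else 0)
      ≡⟨ ∑-cong (allFin q) (λ {e} _ → cong (λ l → if incident w (lookup edges e) then suc l else 0) (toℕ-f₀ e)) ⟩
    ∑[ e ∈ allFin q ] weight w (lookup edges e)
      ≡⟨ ∑-map (lookup edges) (allFin q) (weight w) ⟨
    ∑ (map (lookup edges) (allFin q)) (weight w)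
      ≡⟨ cong (λ ps → ∑ ps (weight w)) (trans (map-tabulate id (lookup edges)) (tabulate-lookup edges)) ⟩
    ∑ (rungs ++ YZ-edges ++ X-edges) (weight w)
      ≡⟨ ∑-++ rungs _ (weight w) ⟩
    ∑ rungs (weight w) + ∑ (YZ-edges ++ X-edges) (weight w)
      ≡⟨ cong₂ _+_ (∑-map (λ i → u i , v i) (interval 1 N) (weight w)) (∑-++ YZ-edges X-edges (weight w)) ⟩
    rungPart w + (∑ YZ-edges (weight w) + ∑ X-edges (weight w))
      ≡⟨ cong (λ x → rungPart w + x) (cong₂ _+_ YZ-edges-part X-edges-part) ⟩
    rungPart w + (YZPart w + XPart w)
      ∎
    where
    open ≡-Reasoning
    YZ-edges-part : ∑ YZ-edges (weight w) ≡ YZPart w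
    YZ-edges-part = trans (∑-concatMap YZ-block (interval 1 r) (weight w)) (∑-cong (interval 1 r) λ {a} _ →
      trans (∑-concatMap (YZ-column a) columns (weight w)) (∑-cong columns λ {j} _ → ∑-concatMap (YZ-spokes a j) (I a) (weight w)))
    X-edges-part : ∑ X-edges (weight w) ≡ XPart w
    X-edges-part = trans (∑-concatMap X-column columns (weight w)) (∑-cong columns λ {j} _ → ∑-concatMap (X-spokes j) M (weight w))

  σ-op : ∀ j {i} → IsIndex i → suc (σ j i + σ j (op i)) ≡ N
  σ-op j {suc i} (_ , i<N) = by-case (j ≤ᵇ n)
    where
    by-case : ∀ b → suc ((if b then i else N ∸ suc i) + (if b then N ∸ i ∸ 1 else N ∸ (N ∸ i))) ≡ N
    by-case true  = trans (cong (λ d → suc (i + d)) (trans (∸-+-assoc N i 1) (cong (N ∸_) (+-comm i 1)))) (m+[n∸m]≡n i<N)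
    by-case false = trans (cong suc (trans (cong (N ∸ suc i +_) (m∸[m∸n]≡n (<⇒≤ i<N))) (+-comm (N ∸ suc i) i))) (m+[n∸m]≡n i<N)

  pairSum : ℕ
  pairSum = suc (2 * N + 2 * P)

  spoke-pair : ∀ {i j} → IsIndex i → j ∈ columns → suc (spokeU i j) + suc (spokeV (op i) j) ≡ pairSum
  spoke-pair {i} {j} idx j∈ = begin
    suc (j * N + σ j i) + suc (P + (suc T ∸ j) * N + σ j (op i))  ≡⟨ regroup j (suc T ∸ j) (σ j i) (σ j (op i)) P N ⟩
    suc (P + (j + (suc T ∸ j)) * N + suc (σ j i + σ j (op i)))     ≡⟨ cong₂ (λ c d → suc (P + c * N + d)) j+[1+T∸j] (σ-op j idx) ⟩
    suc (P + suc T * N + N)                                        ≡⟨ total T N ⟩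
    pairSum                                                        ∎
    where
    open ≡-Reasoning
    j+[1+T∸j] : j + (suc T ∸ j) ≡ suc T
    j+[1+T∸j] = m+[n∸m]≡n (m≤n⇒m≤1+n (proj₂ (∈-interval⁻ j∈)))
    regroup : ∀ j k a b P N → suc (j * N + a) + suc (P + k * N + b) ≡ suc (P + (j + k) * N + suc (a + b))
    regroup = solve-∀
    total : ∀ T N → suc (T * N + suc T * N + N) ≡ suc (2 * N + 2 * (T * N))
    total = solve-∀

  rowU rowV : ℕ → ℕ
  rowU i = ∑[ j ∈ columns ] suc (spokeU i j)
  rowV i = ∑[ j ∈ columns ] suc (spokeV i j)

  K valueU valueV valueHub : ℕ
  K = 2 * suc n * N
  valueU = suc n + suc n * K
  valueV = (N + suc n) + (3 * n + 1) * K
  valueHub = S * pairSum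

  ∑-columns : ∑[ j ∈ columns ] j ≡ T * suc n
  ∑-columns = *-cancelˡ-≡ (∑[ j ∈ columns ] j) (T * suc n) 2 (trans (2*∑-interval T) (lemma n))
    where
    lemma : ∀ n → (2 * n + 1) * suc (2 * n + 1) ≡ 2 * ((2 * n + 1) * suc n)
    lemma = solve-∀

  ∑-σ : ∀ i → ∑[ j ∈ columns ] σ j i ≡ n * (i ∸ 1) + suc n * (N ∸ i)
  ∑-σ i = trans (cong (λ m → ∑[ j ∈ interval 1 m ] σ j i) (lemma n)) (∑-threshold n (suc n) (i ∸ 1) (N ∸ i))
    where
    lemma : ∀ n → 2 * n + 1 ≡ n + suc n
    lemma = solve-∀

  u-row : ∀ {i} → IsIndex i → i + rowU i ≡ valueU
  u-row {suc i} (_ , i<N) = begin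
    suc i + rowU (suc i)
      ≡⟨ cong (suc i +_) (∑-+ columns (λ j → suc (j * N)) (λ j → σ j (suc i))) ⟩
    suc i + (∑[ j ∈ columns ] (1 + j * N) + ∑[ j ∈ columns ] σ j (suc i))
      ≡⟨ cong (λ x → suc i + (x + ∑[ j ∈ columns ] σ j (suc i))) (∑-+ columns (λ _ → 1) (λ j → j * N)) ⟩
    suc i + (∑[ j ∈ columns ] 1 + ∑[ j ∈ columns ] (j * N) + ∑[ j ∈ columns ] σ j (suc i))
      ≡⟨ cong₂ (λ x y → suc i + (x + y)) (cong₂ _+_ (trans (∑-const columns 1) (cong (_* 1) (length-interval 1 T)))
                                                    (trans (∑-*ʳ columns (λ j → j) N) (cong (_* N) ∑-columns)))
                                         (∑-σ (suc i)) ⟩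
    suc i + (T * 1 + T * suc n * N + (n * i + suc n * (N ∸ suc i)))
      ≡⟨ arithmetic n i (N ∸ suc i) N (m+[n∸m]≡n i<N) ⟩
    valueU ∎
    where
    open ≡-Reasoning
    arithmetic : ∀ n i d N → suc (i + d) ≡ N →
      suc i + ((2 * n + 1) * 1 + (2 * n + 1) * suc n * N + (n * i + suc n * d)) ≡ suc n + suc n * (2 * suc n * N)
    arithmetic n i d _ refl = lemma n i d
      where
      lemma : ∀ n i d → suc i + ((2 * n + 1) * 1 + (2 * n + 1) * suc n * suc (i + d) + (n * i + suc n * d))
                        ≡ suc n + suc n * (2 * suc n * suc (i + d))
      lemma = solve-∀

  spoke-pair-op : ∀ {i j} → IsIndex i → j ∈ columns → suc (spokeU (op i) j) + suc (spokeV i j) ≡ pairSum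
  spoke-pair-op {i} {j} idx@(_ , i≤N) j∈ =
    subst (λ k → suc (spokeU (op i) j) + suc (spokeV k j) ≡ pairSum) (op-involutive i≤N) (spoke-pair (op-index idx) j∈)

  paired-rows : ∀ {i} → IsIndex i → rowU (op i) + rowV i ≡ T * pairSum
  paired-rows {i} idx = begin
    rowU (op i) + rowV i                                        ≡⟨ ∑-+ columns (λ j → suc (spokeU (op i) j)) (λ j → suc (spokeV i j)) ⟨
    ∑[ j ∈ columns ] (suc (spokeU (op i) j) + suc (spokeV i j)) ≡⟨ ∑-cong columns (spoke-pair-op idx) ⟩
    ∑[ j ∈ columns ] pairSum                                    ≡⟨ ∑-const columns pairSum ⟩
    length columns * pairSum                                    ≡⟨ cong (_* pairSum) (length-interval 1 T) ⟩
    T * pairSum                                                 ∎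
    where open ≡-Reasoning

  v-row : ∀ {i} → IsIndex i → i + rowV i ≡ valueV
  v-row {i} idx@(_ , i≤N) = +-cancelʳ-≡ valueU (i + rowV i) valueV (begin
    i + rowV i + valueU                            ≡⟨ cong (i + rowV i +_) (u-row (op-index idx)) ⟨
    i + rowV i + (op i + rowU (op i))         ≡⟨ rearrange i (rowV i) (op i) (rowU (op i)) ⟩
    (i + op i) + (rowU (op i) + rowV i)       ≡⟨ cong₂ _+_ (m+[n∸m]≡n (m≤n⇒m≤1+n i≤N)) (paired-rows idx) ⟩
    suc N + T * pairSum                       ≡⟨ total n N ⟨
    valueV + valueU                                     ∎)
    where
    open ≡-Reasoning
    rearrange : ∀ a b c d → a + b + (c + d) ≡ (a + c) + (d + b)
    rearrange = solve-∀
    total : ∀ n N → (N + suc n) + (3 * n + 1) * (2 * suc n * N) + (suc n + suc n * (2 * suc n * N))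
                    ≡ suc N + (2 * n + 1) * suc (2 * N + 2 * ((2 * n + 1) * N))
    total = solve-∀

  δ-op : ∀ {i k} → IsIndex i → IsIndex k → δ i (op k) ≡ δ (op i) k
  δ-op (_ , i≤N) (_ , k≤N) =
    δ-cong (λ i≡opk → trans (cong op i≡opk) (op-involutive k≤N)) (λ opi≡k → trans (sym (op-involutive i≤N)) (cong op opi≡k))

  ∑-δ-op : ∀ {i} ks → (∀ {k} → k ∈ ks → IsIndex k) → IsIndex i → ∑[ k ∈ ks ] δ i (op k) ≡ occurrences (op i) ks
  ∑-δ-op ks index idx = ∑-cong ks (λ k∈ → δ-op idx (index k∈))

  rung-sum : ∀ {i} → IsIndex i → ∑[ k ∈ interval 1 N ] (if ⌊ i ≟ k ⌋ then suc (k ∸ 1) else 0) ≡ i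
  rung-sum {suc i} (1≤i , i≤N) = ∑-if-δ (λ k → suc (k ∸ 1)) (interval-unique 1 N) (∈-interval⁺ 1≤i i≤N)

  fplus-u : ∀ {i} → IsIndex i → fplus f₀ (u i) ≡ valueU
  fplus-u {i} idx = begin
    fplus f₀ (u i)                                                          ≡⟨ fplus-f₀ (u i) ⟩
    rungPart (u i) + (YZPart (u i) + XPart (u i))                           ≡⟨ cong₂ _+_ rung-part (cong₂ _+_ YZ-sum X-sum) ⟩
    i + ((occurrences i lower + occurrences (op i) lower) * rowU i + occurrences i M * rowU i)
                                                                            ≡⟨ cong (i +_) (*-distribʳ-≡1 (occurrences i lower + occurrences (op i) lower) (occurrences i M) (rowU i) (proj₁ (spoke-multiplicities idx))) ⟩
    i + rowU i                                                              ≡⟨ u-row idx ⟩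
    valueU                                                                  ∎
    where
    open ≡-Reasoning
    rung-part : rungPart (u i) ≡ i
    rung-part = trans (∑-cong (interval 1 N) (λ {k} _ → cong (if_then suc (k ∸ 1) else 0) (∨-identityʳ ⌊ i ≟ k ⌋))) (rung-sum idx)
    YZ-sum : YZPart (u i) ≡ (occurrences i lower + occurrences (op i) lower) * rowU i
    YZ-sum = begin
      YZPart (u i)
        ≡⟨ ∑YZ-cong (λ {a} {j} {k} _ _ _ → if-δ-+-if-δ i k (op k) (λ k → suc (spokeU k j))) ⟩
      ∑YZ (λ a j k → (δ i k + δ i (op k)) * suc (spokeU i j))
        ≡⟨ ∑-concatMap-separable I (interval 1 r) columns (λ k → δ i k + δ i (op k)) (λ j → suc (spokeU i j)) ⟩
      ∑[ k ∈ lower ] (δ i k + δ i (op k)) * rowU i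
        ≡⟨ cong (_* rowU i) (trans (∑-+ lower (δ i) (λ k → δ i (op k))) (cong (occurrences i lower +_) (∑-δ-op lower lower-index idx))) ⟩
      (occurrences i lower + occurrences (op i) lower) * rowU i
        ∎
    X-sum : XPart (u i) ≡ occurrences i M * rowU i
    X-sum = trans (∑X-cong (λ {j} {k} _ _ → trans (+-identityʳ _) (if-δ i k (λ k → suc (spokeU k j)))))
                  (∑-separable M columns (δ i) (λ j → suc (spokeU i j)))

  fplus-v : ∀ {i} → IsIndex i → fplus f₀ (v i) ≡ valueV
  fplus-v {i} idx = begin
    fplus f₀ (v i)                                                          ≡⟨ fplus-f₀ (v i) ⟩
    rungPart (v i) + (YZPart (v i) + XPart (v i))                           ≡⟨ cong₂ _+_ (rung-sum idx) (cong₂ _+_ YZ-sum X-sum) ⟩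
    i + ((occurrences (op i) lower + occurrences i lower) * rowV i + occurrences (op i) M * rowV i)
                                                                            ≡⟨ cong (i +_) (*-distribʳ-≡1 (occurrences (op i) lower + occurrences i lower) (occurrences (op i) M) (rowV i) (proj₂ (spoke-multiplicities idx))) ⟩
    i + rowV i                                                              ≡⟨ v-row idx ⟩
    valueV                                                                  ∎
    where
    open ≡-Reasoning
    YZ-sum : YZPart (v i) ≡ (occurrences (op i) lower + occurrences i lower) * rowV i
    YZ-sum = begin
      YZPart (v i)
        ≡⟨ ∑YZ-cong (λ {a} {j} {k} _ _ _ → if-δ-+-if-δ i (op k) k (λ k → suc (spokeV k j))) ⟩
      ∑YZ (λ a j k → (δ i (op k) + δ i k) * suc (spokeV i j))
        ≡⟨ ∑-concatMap-separable I (interval 1 r) columns (λ k → δ i (op k) + δ i k) (λ j → suc (spokeV i j)) ⟩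
      ∑[ k ∈ lower ] (δ i (op k) + δ i k) * rowV i
        ≡⟨ cong (_* rowV i) (trans (∑-+ lower (λ k → δ i (op k)) (δ i)) (cong (_+ occurrences i lower) (∑-δ-op lower lower-index idx))) ⟩
      (occurrences (op i) lower + occurrences i lower) * rowV i
        ∎
    X-sum : XPart (v i) ≡ occurrences (op i) M * rowV i
    X-sum = trans (∑X-cong (λ {j} {k} _ _ → trans (+-identityʳ _) (if-δ i (op k) (λ k → suc (spokeV k j)))))
                  (trans (∑-separable M columns (λ k → δ i (op k)) (λ j → suc (spokeV i j)))
                         (cong (_* rowV i) (∑-δ-op M M-index idx)))

  YZ-hub-sum : ∀ {a₀ j₀} → a₀ ∈ interval 1 r → j₀ ∈ columns → ∀ c →
               ∑YZ (λ a j k → 𝟙 (⌊ a₀ ≟ a ⌋ ∧ ⌊ j₀ ≟ j ⌋) * c) ≡ S * c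
  YZ-hub-sum {a₀} {j₀} a₀∈ j₀∈ c = begin
    ∑YZ (λ a j k → 𝟙 (⌊ a₀ ≟ a ⌋ ∧ ⌊ j₀ ≟ j ⌋) * c)
      ≡⟨ ∑-cong (interval 1 r) (λ a∈ → ∑-cong columns (λ {j} _ → block-sum a∈ j)) ⟩
    ∑[ a ∈ interval 1 r ] ∑[ j ∈ columns ] (δ a₀ a * (δ j₀ j * (S * c)))
      ≡⟨ ∑-cong (interval 1 r) (λ {a} _ → trans (∑-*ˡ columns (δ a₀ a) (λ j → δ j₀ j * (S * c)))
                                                (cong (δ a₀ a *_) (∑-δ (λ _ → S * c) (interval-unique 1 T) j₀∈))) ⟩
    ∑[ a ∈ interval 1 r ] (δ a₀ a * (S * c))
      ≡⟨ ∑-δ (λ _ → S * c) (interval-unique 1 r) a₀∈ ⟩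
    S * c
      ∎
    where
    open ≡-Reasoning
    rearrange : ∀ S x y c → S * (x * y * c) ≡ x * (y * (S * c))
    rearrange = solve-∀
    block-sum : ∀ {a} → a ∈ interval 1 r → ∀ j → ∑[ k ∈ I a ] (𝟙 (⌊ a₀ ≟ a ⌋ ∧ ⌊ j₀ ≟ j ⌋) * c) ≡ δ a₀ a * (δ j₀ j * (S * c))
    block-sum {a} a∈ j = begin
      ∑[ k ∈ I a ] (𝟙 (⌊ a₀ ≟ a ⌋ ∧ ⌊ j₀ ≟ j ⌋) * c)       ≡⟨ ∑-const (I a) _ ⟩
      length (I a) * (𝟙 (⌊ a₀ ≟ a ⌋ ∧ ⌊ j₀ ≟ j ⌋) * c)      ≡⟨ cong₂ (λ l b → l * (b * c)) (length-block S a (proj₁ (∈-interval⁻ a∈)))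
                                                                                          (𝟙-∧ ⌊ a₀ ≟ a ⌋ ⌊ j₀ ≟ j ⌋) ⟩
      S * (δ a₀ a * δ j₀ j * c)                             ≡⟨ rearrange S (δ a₀ a) (δ j₀ j) c ⟩
      δ a₀ a * (δ j₀ j * (S * c))                           ∎

  X-hub-sum : ∀ {j₀} → j₀ ∈ columns → ∀ c → ∑X (λ j k → 𝟙 ⌊ j₀ ≟ j ⌋ * c) ≡ S * c
  X-hub-sum {j₀} j₀∈ c = begin
    ∑X (λ j k → δ j₀ j * c)             ≡⟨ ∑-cong columns (λ {j} _ → trans (∑-const M (δ j₀ j * c)) (cong (_* (δ j₀ j * c)) length-M)) ⟩
    ∑[ j ∈ columns ] (S * (δ j₀ j * c)) ≡⟨ ∑-cong columns (λ {j} _ → *-assoc-comm S (δ j₀ j) c) ⟩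
    ∑[ j ∈ columns ] (δ j₀ j * (S * c)) ≡⟨ ∑-δ (λ _ → S * c) (interval-unique 1 T) j₀∈ ⟩
    S * c                               ∎
    where
    open ≡-Reasoning
    *-assoc-comm : ∀ S x c → S * (x * c) ≡ x * (S * c)
    *-assoc-comm = solve-∀

  ∑YZ-0 : ∑YZ (λ _ _ _ → 0) ≡ 0
  ∑YZ-0 = trans (∑-cong (interval 1 r) λ {a} _ → trans (∑-cong columns λ _ → ∑-0 (I a)) (∑-0 columns)) (∑-0 (interval 1 r))

  ∑X-0 : ∑X (λ _ _ → 0) ≡ 0
  ∑X-0 = trans (∑-cong columns λ _ → ∑-0 M) (∑-0 columns)

  fplus-hub : ∀ {h} → Hub h → fplus f₀ h ≡ valueHub
  fplus-hub {h} hub = begin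
    fplus f₀ h                             ≡⟨ fplus-f₀ h ⟩
    rungPart h + (YZPart h + XPart h)      ≡⟨ cong (rungPart h +_) (parts hub) ⟩
    rungPart h + S * pairSum               ≡⟨ cong (_+ S * pairSum) (rungs-0 hub) ⟩
    valueHub                               ∎
    where
    open ≡-Reasoning
    rungs-0 : ∀ {h} → Hub h → rungPart h ≡ 0
    rungs-0 (Y-hub _ _) = ∑-0 (interval 1 N)
    rungs-0 (Z-hub _ _) = ∑-0 (interval 1 N)
    rungs-0 (X-hub _)   = ∑-0 (interval 1 N)
    parts : ∀ {h} → Hub h → YZPart h + XPart h ≡ S * pairSum
    parts (Y-hub {a₀} {j₀} a₀∈ j₀∈) = trans (cong₂ _+_ YZ-sum ∑X-0) (+-identityʳ (S * pairSum))
      where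
      YZ-sum : YZPart (Y a₀ j₀) ≡ S * pairSum
      YZ-sum = trans (∑YZ-cong λ {a} {j} {k} a∈ j∈ k∈ → trans (if-+-if (⌊ a₀ ≟ a ⌋ ∧ ⌊ j₀ ≟ j ⌋) _ _)
                                                              (cong (𝟙 (⌊ a₀ ≟ a ⌋ ∧ ⌊ j₀ ≟ j ⌋) *_) (spoke-pair (block-index a∈ k∈) j∈)))
                     (YZ-hub-sum a₀∈ j₀∈ pairSum)
    parts (Z-hub {a₀} {j₀} a₀∈ j₀∈) = trans (cong₂ _+_ YZ-sum ∑X-0) (+-identityʳ (S * pairSum))
      where
      YZ-sum : YZPart (Z a₀ j₀) ≡ S * pairSum
      YZ-sum = trans (∑YZ-cong λ {a} {j} {k} a∈ j∈ k∈ → trans (if-+-if (⌊ a₀ ≟ a ⌋ ∧ ⌊ j₀ ≟ j ⌋) _ _)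
                                                              (cong (𝟙 (⌊ a₀ ≟ a ⌋ ∧ ⌊ j₀ ≟ j ⌋) *_)
                                                                    (trans (+-comm (suc (spokeV k j)) (suc (spokeU (op k) j))) (spoke-pair-op (block-index a∈ k∈) j∈))))
                     (YZ-hub-sum a₀∈ j₀∈ pairSum)
    parts (X-hub {j₀} j₀∈) = cong₂ _+_ ∑YZ-0 X-sum
      where
      X-sum : XPart (X j₀) ≡ S * pairSum
      X-sum = trans (∑X-cong λ {j} {k} j∈ k∈ → trans (if-+-if ⌊ j₀ ≟ j ⌋ _ _) (cong (δ j₀ j *_) (spoke-pair (M-index k∈) j∈)))
                    (X-hub-sum j₀∈ pairSum)

  -- The three vertex sums are distinct

  K-nonZero : NonZero K
  K-nonZero = >-nonZero (<-≤-trans 1≤N (m≤n*m N (2 * suc n)))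

  K≡ : K ≡ N + (N + 2 * n * N)
  K≡ = lemma n N
    where
    lemma : ∀ n N → 2 * suc n * N ≡ N + (N + 2 * n * N)
    lemma = solve-∀

  valueHub≡ : valueHub ≡ S + 2 * S * K
  valueHub≡ = lemma n N S
    where
    lemma : ∀ n N S → S * suc (2 * N + 2 * ((2 * n + 1) * N)) ≡ S + 2 * S * (2 * suc n * N)
    lemma = solve-∀

  S<K : S < K
  S<K = subst (S <_) (sym K≡) (≤-<-trans S≤N (m<m+n N (≤-trans 1≤N (m≤m+n N _))))

  1+n<K : suc n < K
  1+n<K = <-≤-trans (m<m+n (suc n) (s≤s z≤n)) (m≤m*n (2 * suc n) N ⦃ N-nonZero ⦄)

  valueU<valueV : valueU < valueV
  valueU<valueV = +-mono-<-≤ (m<n+m (suc n) 1≤N) (*-monoˡ-≤ K (subst (_≤ 3 * n + 1) (+-comm n 1) (+-monoˡ-≤ 1 (m≤m+n n (2 * n)))))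

  valueU≢valueHub : valueU ≢ valueHub
  valueU≢valueHub eq = <-irrefl (trans (sym (proj₁ digits)) (proj₂ digits)) (m<m+n S (≤-trans 1≤S (m≤m+n S 0)))
    where
    digits : suc n ≡ S × suc n ≡ 2 * S
    digits = euclidean-division-unique {K} {suc n} {S} (suc n) (2 * S) ⦃ K-nonZero ⦄ 1+n<K S<K (trans eq valueHub≡)

  N+1+n<K : 1 ≤ n → N + suc n < K
  N+1+n<K 1≤n = subst (N + suc n <_) (sym K≡) (+-monoʳ-< N (≤-<-trans 1+n≤2nN (m<n+m (2 * n * N) 1≤N)))
    where
    1+n≤2nN : suc n ≤ 2 * n * N
    1+n≤2nN = ≤-trans (subst (_≤ 2 * n) (+-comm n 1) (+-monoʳ-≤ n (≤-trans 1≤n (m≤m+n n 0)))) (m≤m*n (2 * n) N ⦃ N-nonZero ⦄)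

  valueV≢valueHub : 1 ≤ n → valueV ≢ valueHub
  valueV≢valueHub 1≤n eq = <-irrefl (sym (proj₁ digits)) (≤-<-trans S≤N (m<m+n N (s≤s z≤n)))
    where
    digits : N + suc n ≡ S × 3 * n + 1 ≡ 2 * S
    digits = euclidean-division-unique {K} {N + suc n} {S} (3 * n + 1) (2 * S) ⦃ K-nonZero ⦄ (N+1+n<K 1≤n) S<K (trans eq valueHub≡)

  f₀-proper : 1 ≤ n → ∀ {p} → Shape p → fplus f₀ (proj₁ p) ≢ fplus f₀ (proj₂ p)
  f₀-proper _   (rung idx)        eq = <-irrefl (trans (sym (fplus-u idx)) (trans eq (fplus-v idx))) valueU<valueV
  f₀-proper _   (spoke-u hub idx) eq = valueU≢valueHub (trans (sym (fplus-u idx)) (trans (sym eq) (fplus-hub hub)))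
  f₀-proper 1≤n (spoke-v hub idx) eq = valueV≢valueHub 1≤n (trans (sym (fplus-v idx)) (trans (sym eq) (fplus-hub hub)))

  f₀-localAntimagic : 1 ≤ n → LocalAntimagic f₀
  f₀-localAntimagic 1≤n = f₀-bijective , λ e → f₀-proper 1≤n (shape (∈-lookup {xs = edges} e))

  data Vertex : V → Set where
    u-vertex   : ∀ {i} → IsIndex i → Vertex (u i)
    v-vertex   : ∀ {i} → IsIndex i → Vertex (v i)
    hub-vertex : ∀ {h} → Hub h → Vertex h

  YZ-hubs : ℕ → List V
  YZ-hubs a = map (Y a) columns ++ map (Z a) columns

  vertex : ∀ {w} → w ∈ vertices → Vertex w
  vertex w∈ with ∈-++⁻ (map u (interval 1 N)) w∈
  ... | inj₁ w∈u with ∈-map⁻ u {xs = interval 1 N} w∈u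
  ...   | i , i∈ , refl = u-vertex (∈-interval⁻ i∈)
  vertex w∈ | inj₂ w∈′ with ∈-++⁻ (map v (interval 1 N)) w∈′
  ... | inj₁ w∈v with ∈-map⁻ v {xs = interval 1 N} w∈v
  ...   | i , i∈ , refl = v-vertex (∈-interval⁻ i∈)
  vertex w∈ | inj₂ _ | inj₂ w∈″ with ∈-++⁻ (concatMap YZ-hubs (interval 1 r)) w∈″
  ... | inj₂ w∈X with ∈-map⁻ X {xs = columns} w∈X
  ...   | j , j∈ , refl = hub-vertex (X-hub j∈)
  vertex w∈ | inj₂ _ | inj₂ _ | inj₁ w∈YZ with ∈-concatMap⁻-∃ YZ-hubs (interval 1 r) w∈YZ
  ... | a , a∈ , w∈a with ∈-++⁻ (map (Y a) columns) w∈a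
  ...   | inj₁ w∈Y with ∈-map⁻ (Y a) {xs = columns} w∈Y
  ...     | j , j∈ , refl = hub-vertex (Y-hub a∈ j∈)
  vertex w∈ | inj₂ _ | inj₂ _ | inj₁ _ | a , a∈ , _ | inj₂ w∈Z with ∈-map⁻ (Z a) {xs = columns} w∈Z
  ...   | j , j∈ , refl = hub-vertex (Z-hub a∈ j∈)

  fplus-f₀-vertex : ∀ {w} → Vertex w → fplus f₀ w ∈ valueU ∷ valueV ∷ valueHub ∷ []
  fplus-f₀-vertex (u-vertex idx)   = here (fplus-u idx)
  fplus-f₀-vertex (v-vertex idx)   = there (here (fplus-v idx))
  fplus-f₀-vertex (hub-vertex hub) = there (there (here (fplus-hub hub)))

  colorNumber-f₀≤3 : colorNumber f₀ ≤ 3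
  colorNumber-f₀≤3 = unique-⊆⇒length≤ (deduplicate-! (map (fplus f₀) vertices)) colours
    where
    colours : deduplicate _≟_ (map (fplus f₀) vertices) ⊆ valueU ∷ valueV ∷ valueHub ∷ []
    colours y∈ = colour (∈-map⁻ (fplus f₀) (∈-deduplicate⁻ _≟_ (map (fplus f₀) vertices) y∈))
      where
      colour : ∀ {y} → (∃ λ w → w ∈ vertices × y ≡ fplus f₀ w) → y ∈ valueU ∷ valueV ∷ valueHub ∷ []
      colour (w , w∈ , refl) = fplus-f₀-vertex (vertex w∈)

  centre : ℕ
  centre = L + suc s

  centre∈M : centre ∈ M
  centre∈M = middle∈M (subst (suc L ≤_) (sym (+-suc L s)) (s≤s (m≤m+n L s))) (+-monoʳ-≤ L (subst (suc s ≤_) (+-comm 1 (2 * s)) (s≤s (m≤m+n s (s + 0)))))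

  op-centre : op centre ≡ centre
  op-centre = trans (cong (_∸ centre) (lemma r s)) (m+n∸m≡n centre centre)
    where
    lemma : ∀ r s → suc ((2 * r + 1) * (2 * s + 1)) ≡ r * (2 * s + 1) + suc s + (r * (2 * s + 1) + suc s)
    lemma = solve-∀

  vertex∈ : ∀ {w} → Vertex w → w ∈ vertices
  vertex∈ (u-vertex (1≤i , i≤N)) = ∈-++⁺ˡ (∈-map⁺ u (∈-interval⁺ 1≤i i≤N))
  vertex∈ (v-vertex (1≤i , i≤N)) = ∈-++⁺ʳ (map u (interval 1 N)) (∈-++⁺ˡ (∈-map⁺ v (∈-interval⁺ 1≤i i≤N)))
  vertex∈ (hub-vertex (Y-hub {a} a∈ j∈)) =
    ∈-++⁺ʳ (map u (interval 1 N)) (∈-++⁺ʳ (map v (interval 1 N)) (∈-++⁺ˡ (∈-concatMap⁺-∃ YZ-hubs a∈ (∈-++⁺ˡ (∈-map⁺ (Y a) j∈)))))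
  vertex∈ (hub-vertex (Z-hub {a} a∈ j∈)) =
    ∈-++⁺ʳ (map u (interval 1 N)) (∈-++⁺ʳ (map v (interval 1 N)) (∈-++⁺ˡ (∈-concatMap⁺-∃ YZ-hubs a∈ (∈-++⁺ʳ (map (Y a) columns) (∈-map⁺ (Z a) j∈)))))
  vertex∈ (hub-vertex (X-hub j∈)) =
    ∈-++⁺ʳ (map u (interval 1 N)) (∈-++⁺ʳ (map v (interval 1 N)) (∈-++⁺ʳ (concatMap YZ-hubs (interval 1 r)) (∈-map⁺ X j∈)))

  colorNumber≥3 : ∀ g → LocalAntimagic g → 3 ≤ colorNumber g
  colorNumber≥3 g (_ , proper) = unique-⊆⇒length≤ distinct triangle⊆
    where
    proper-edge : ∀ {x y} → (x , y) ∈ edges → fplus g x ≢ fplus g y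
    proper-edge xy∈ eq = proper (index xy∈) (subst (λ p → fplus g (proj₁ p) ≡ fplus g (proj₂ p)) (lookup-index xy∈) eq)
    idx : IsIndex centre
    idx = M-index centre∈M
    1∈columns : 1 ∈ columns
    1∈columns = ∈-interval⁺ ≤-refl (m≤n+m 1 (2 * n))
    distinct : Unique (fplus g (u centre) ∷ fplus g (v centre) ∷ fplus g (X 1) ∷ [])
    distinct = (proper-edge (rung∈edges idx) ∷ (λ eq → proper-edge (X-spoke∈edges 1∈columns centre∈M (here refl)) (sym eq)) ∷ [])
             ∷ ((λ eq → proper-edge (subst (λ k → (X 1 , v k) ∈ edges) op-centre (X-spoke∈edges 1∈columns centre∈M (there (here refl)))) (sym eq)) ∷ [])
             ∷ [] ∷ []
    triangle⊆ : fplus g (u centre) ∷ fplus g (v centre) ∷ fplus g (X 1) ∷ [] ⊆ deduplicate _≟_ (map (fplus g) vertices)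
    triangle⊆ (here refl)                 = ∈-deduplicate⁺ _≟_ (∈-map⁺ (fplus g) (vertex∈ (u-vertex idx)))
    triangle⊆ (there (here refl))         = ∈-deduplicate⁺ _≟_ (∈-map⁺ (fplus g) (vertex∈ (v-vertex idx)))
    triangle⊆ (there (there (here refl))) = ∈-deduplicate⁺ _≟_ (∈-map⁺ (fplus g) (vertex∈ (hub-vertex (X-hub 1∈columns))))

  colorNumber-f₀ : 1 ≤ n → colorNumber f₀ ≡ 3
  colorNumber-f₀ 1≤n = ≤-antisym colorNumber-f₀≤3 (colorNumber≥3 f₀ (f₀-localAntimagic 1≤n))

-- The construction needs no assumption on r and s.
theorem3p2 : (n r s : ℕ) → 1 ≤ n → 1 ≤ r → 1 ≤ s → Graph.χla≡ n r s 3
theorem3p2 n r s 1≤n _ _ = (f₀ , f₀-localAntimagic 1≤n , colorNumber-f₀ 1≤n) , colorNumber≥3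
  where open Construction n r s
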